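{- Let $y,z$ be integers with $y,z>1$ and $y\ne z$. Let $(b(n))_{n\ge1}$ be the $(0,z-1,y,z)$-hiccup sequence, and define $a(1)=0$ and $a(n+1)=b(n)+1$ for $n\ge1$. Then $(a(n))_{n\ge1}$ is the $(0,0,y,z)$-hiccup sequence. In particular, the sequence $(a(n+1))_{n\ge1}$ is morphic.
   Context: For $x\in\mathbb{Z}_{\ge0}$ and $y,z\in\mathbb{Z}_{\ge1}$ with $y\ne z$, the $(0,x,y,z)$-hiccup sequence is the integer sequence $(a(n))_{n\ge1}$ defined by $a(1)=x$ and, for $n\ge 2$, $a(n)=a(n-1)+y$ if $n\in\{a(k):1\le k<n\}$, and $a(n)=a(n-1)+z$ otherwise. The characteristic sequence of an increasing sequence of positive integers $(a(n))$ is the binary sequence $(c(m))_{m\ge1}$ with $c(m)=1$ if $m=a(k)$ for some $k$ and $c(m)=0$ otherwise. A binary sequence $(c(m))_{m\ge1}$ is morphic if there exist a finite alphabet $\Sigma$, a morphism $\phi:\Sigma\to\Sigma^*$, a letter $s\in\Sigma$ such that $\phi(s)$ begins with $s$ and the lengths of $\phi^n(s)$ are unbounded (so $w=\phi^\infty(s)=w_1w_2\cdots$ is an infinite fixed point of $\phi$), and a letter-to-letter coding $\pi:\Sigma\to\{0,1\}$ with $c(m)=\pi(w_m)$ for all $m\ge1$. An increasing sequence is morphic if its characteristic sequence is morphic. -}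

module Defs where

open import Data.Nat using (ℕ; zero; suc; _+_; _∸_; _≤_; _<_)
open import Data.Bool using (Bool; true)
open import Data.Fin using (Fin)
open import Data.List using (List; []; _∷_; length; concatMap)
open import Data.Maybe using (Maybe; just; nothing)
open import Data.Product using (Σ; ∃; _×_; _,_)
open import Relation.Binary.PropositionalEquality using (_≡_)
open import Relation.Nullary using (¬_)
open import Function.Bundles using (_⇔_)

-- Sequences (a(n))_{n≥1} are represented by functions ℕ → ℕ; the value at 0 is ignored.

EarlierValue : (ℕ → ℕ) → ℕ → Set
EarlierValue a n = ∃ λ k → (1 ≤ k) × (k < n) × (a k ≡ n)

IsHiccup : ℕ → ℕ → ℕ → (ℕ → ℕ) → Set
IsHiccup x y z a =
  (a 1 ≡ x) ×
  (∀ n → 2 ≤ n → EarlierValue a n → a n ≡ a (n ∸ 1) + y) ×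
  (∀ n → 2 ≤ n → ¬ EarlierValue a n → a n ≡ a (n ∸ 1) + z)

InRange : (ℕ → ℕ) → ℕ → Set
InRange a m = ∃ λ k → (1 ≤ k) × (a k ≡ m)

extend : ∀ {k} → (Fin k → List (Fin k)) → List (Fin k) → List (Fin k)
extend φ w = concatMap φ w

iter : ∀ {k} → (Fin k → List (Fin k)) → ℕ → List (Fin k) → List (Fin k)
iter φ zero w = w
iter φ (suc n) w = extend φ (iter φ n w)

nth : ∀ {A : Set} → List A → ℕ → Maybe A
nth [] _ = nothing
nth (x ∷ xs) zero = just x
nth (x ∷ xs) (suc i) = nth xs i

-- A binary sequence c(m) (m ≥ 1), given by the predicate "c(m) = 1", is morphic:
-- finite alphabet Fin k, morphism φ, letter s with φ(s) beginning with s and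
-- |φ^n(s)| unbounded, coding π, and c(m) = π(w_m) where w = φ^∞(s), i.e.
-- w_m is the m-th letter of φ^n(s) for any n with |φ^n(s)| ≥ m.
MorphicBinary : (ℕ → Set) → Set
MorphicBinary c =
  ∃ λ (k : ℕ) → ∃ λ (φ : Fin k → List (Fin k)) → ∃ λ (s : Fin k) → ∃ λ (π : Fin k → Bool) →
    (∃ λ t → φ s ≡ s ∷ t) ×
    (∀ N → ∃ λ n → N ≤ length (iter φ n (s ∷ []))) ×
    (∀ m → 1 ≤ m → ∀ n l → nth (iter φ n (s ∷ [])) (m ∸ 1) ≡ just l → ((π l ≡ true) ⇔ c m))

MorphicSeq : (ℕ → ℕ) → Set
MorphicSeq a = MorphicBinary (InRange a)

shiftSeq : (ℕ → ℕ) → ℕ → ℕ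
shiftSeq b zero = 0
shiftSeq b (suc zero) = 0
shiftSeq b (suc (suc n)) = suc (b (suc n))

-- Shifting: a(n+1) = b(n) + 1, and n+1 is an earlier term of a exactly when n is an earlier
-- term of b, so both sequences take the same steps; the first step a(2) = z comes from b(1) = z - 1.
--
-- Morphic: write y = 2 + y₂, z = 2 + z₂ and t(n) = a(n+1).  Every gap t(n+1) - t(n) is y or z,
-- so the characteristic word is a concatenation of blocks 0^{g-1}1, the block of gap 2 + e being
-- coded as gap^e pre hit.  A letter at position q says whether q + 1 is an earlier term (pre) or
-- not (gap, hit), that is, whether the gap t(q) - t(q-1) is y or z.  Hence the morphism sending
-- pre to the y-block and gap, hit to the z-block maps the blocks covering (t(n), t(n+1)] to the
-- blocks covering (t(t(n)), t(t(n+1))], and iterating it from position 1 produces the whole word.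
-- Position 1 needs a letter of its own: when z = 2 the term t(1) = 2 is not an earlier term.

module Submission where

open import Defs
open import Data.Nat using (ℕ; zero; suc; _+_; _∸_; _<_; _≤_; z≤n; s≤s; _≤?_)
open import Data.Nat.Properties
open import Data.Bool using (Bool; true; false)
open import Data.Fin using (Fin; zero; suc)
open import Data.List using (List; []; _∷_; _++_; length; replicate; concatMap)
open import Data.List.Properties using (concatMap-++; length-++; ++-assoc)
open import Data.Maybe using (just)
open import Data.Maybe.Properties using (just-injective)
open import Data.Product using (_×_; _,_; ∃; proj₁; proj₂)
open import Data.Sum using (inj₁; inj₂)
open import Data.Unit using (⊤; tt)
open import Function using (_∘_)
open import Function.Bundles using (_⇔_; mk⇔)
open import Relation.Nullary using (¬_; Dec; yes; no; contradiction)
open import Relation.Nullary.Decidable using (decidable-stable; ¬¬-excluded-middle)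
open import Relation.Binary.PropositionalEquality

by-cases : ∀ {P Q : Set} → Dec Q → (P → Q) → (¬ P → Q) → Q
by-cases Q? p⇒q ¬p⇒q = decidable-stable Q? λ ¬q →
  ¬¬-excluded-middle λ { (yes p) → ¬q (p⇒q p) ; (no ¬p) → ¬q (¬p⇒q ¬p) }

module _ {f : ℕ → ℕ} (f-step : ∀ n → f n ≤ f (suc n)) where

  mono-≤ : ∀ {m n} → m ≤ n → f m ≤ f n
  mono-≤ {n = zero} z≤n = ≤-refl
  mono-≤ {m} {suc n} m≤1+n with m≤n⇒m<n∨m≡n m≤1+n
  ... | inj₁ m<1+n = ≤-trans (mono-≤ (≤-pred m<1+n)) (f-step n)
  ... | inj₂ refl  = ≤-refl

  ≢-between : ∀ {n v} k → f n < v → v < f (suc n) → f k ≢ v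
  ≢-between {n} k lo hi refl with k ≤? n
  ... | yes k≤n = <⇒≱ lo (mono-≤ k≤n)
  ... | no k≰n  = <⇒≱ hi (mono-≤ (≰⇒> k≰n))

module _ {A : Set} (π : A → Bool) (P : ℕ → Set) where

  Codes : List A → ℕ → Set
  Codes []      m = ⊤
  Codes (x ∷ w) m = ((π x ≡ true) ⇔ P m) × Codes w (suc m)

  Codes-++ : ∀ u {v} m → Codes u m → Codes v (length u + m) → Codes (u ++ v) m
  Codes-++ []      m _             cv = cv
  Codes-++ (x ∷ u) m (cx , cu) cv =
    cx , Codes-++ u (suc m) cu (subst (Codes _) (sym (+-suc (length u) m)) cv)

  Codes-nth : ∀ w m i {x} → Codes w m → nth w i ≡ just x → (π x ≡ true) ⇔ P (i + m)
  Codes-nth (x ∷ w) m zero    (cx , _) eq rewrite just-injective eq = cx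
  Codes-nth (x ∷ w) m (suc i) {y} (_ , cw) eq =
    subst (λ j → (π y ≡ true) ⇔ P j) (+-suc i m) (Codes-nth w (suc m) i cw eq)

false⇔ : ∀ {P : Set} → ¬ P → (false ≡ true) ⇔ P
false⇔ ¬p = mk⇔ (λ ()) (λ p → contradiction p ¬p)

true⇔ : ∀ {P : Set} → P → (true ≡ true) ⇔ P
true⇔ p = mk⇔ (λ _ → p) (λ _ → refl)

module _ {k} (φ : Fin k → List (Fin k)) (expanding : ∀ x → 2 ≤ length (φ x)) where

  length-concatMap-≥ : ∀ w → length w + length w ≤ length (concatMap φ w)
  length-concatMap-≥ []      = z≤n
  length-concatMap-≥ (x ∷ w) =
    subst₂ _≤_ (sym (cong suc (+-suc (length w) (length w)))) (sym (length-++ (φ x)))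
      (+-mono-≤ (expanding x) (length-concatMap-≥ w))

  length-iter-> : ∀ s n → n < length (iter φ n (s ∷ []))
  length-iter-> s zero    = s≤s z≤n
  length-iter-> s (suc n) =
    ≤-trans (s≤s (m≤n+m (suc n) n))
      (≤-trans (+-mono-≤ (length-iter-> s n) (length-iter-> s n))
               (length-concatMap-≥ (iter φ n (s ∷ []))))

  morphic-by-codes : ∀ {P : ℕ → Set} s π → (∃ λ w → φ s ≡ s ∷ w) →
                     (∀ n → Codes π P (iter φ n (s ∷ [])) 1) → MorphicBinary P
  morphic-by-codes {P} s π head codes =
    k , φ , s , π , head , (λ N → N , <⇒≤ (length-iter-> s N)) , coding
    where
    coding : ∀ m → 1 ≤ m → ∀ n l → nth (iter φ n (s ∷ [])) (m ∸ 1) ≡ just l → (π l ≡ true) ⇔ P m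
    coding (suc m) _ n l eq =
      subst (λ j → (π l ≡ true) ⇔ P j) (+-comm m 1) (Codes-nth π P _ 1 m (codes n) eq)

shiftSeq-isHiccup : ∀ {x y} b → IsHiccup x y (suc x) b → IsHiccup 0 y (suc x) (shiftSeq b)
shiftSeq-isHiccup {x} {y} b (b₁ , earlier , fresh) = refl , earlier′ , fresh′
  where
  shift : ∀ n → EarlierValue b (2 + n) → EarlierValue (shiftSeq b) (3 + n)
  shift n (zero , () , _)
  shift n (suc k , _ , k<n , eq) = suc (suc k) , s≤s z≤n , s≤s k<n , cong suc eq

  unshift : ∀ n → EarlierValue (shiftSeq b) (3 + n) → EarlierValue b (2 + n)
  unshift n (suc zero , _ , _ , ())
  unshift n (suc (suc k) , _ , s≤s k<n , eq) = suc k , s≤s z≤n , k<n , suc-injective eq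

  ¬earlier-2 : ¬ EarlierValue (shiftSeq b) 2
  ¬earlier-2 (suc zero , _ , _ , ())
  ¬earlier-2 (suc (suc k) , _ , s≤s (s≤s ()) , _)

  earlier′ : ∀ n → 2 ≤ n → EarlierValue (shiftSeq b) n → shiftSeq b n ≡ shiftSeq b (n ∸ 1) + y
  earlier′ (suc zero) (s≤s ()) _
  earlier′ (suc (suc zero)) _ ev = contradiction ev ¬earlier-2
  earlier′ (suc (suc (suc n))) _ ev = cong suc (earlier (2 + n) (s≤s (s≤s z≤n)) (unshift n ev))

  fresh′ : ∀ n → 2 ≤ n → ¬ EarlierValue (shiftSeq b) n → shiftSeq b n ≡ shiftSeq b (n ∸ 1) + suc x
  fresh′ (suc zero) (s≤s ()) _
  fresh′ (suc (suc zero)) _ _ = cong suc b₁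
  fresh′ (suc (suc (suc n))) _ ¬ev = cong suc (fresh (2 + n) (s≤s (s≤s z≤n)) (¬ev ∘ shift n))

pattern start = zero
pattern gap   = suc zero
pattern pre   = suc (suc zero)
pattern hit   = suc (suc (suc zero))

π : Fin 4 → Bool
π hit = true
π _   = false

body : ℕ → List (Fin 4)
body e = replicate e gap ++ pre ∷ hit ∷ []

-- startBlock e is body e with its first letter replaced by start.
afterStart : ℕ → List (Fin 4)
afterStart zero    = hit ∷ []
afterStart (suc e) = body e

startBlock : ℕ → List (Fin 4)
startBlock e = start ∷ afterStart e

length-body : ∀ e → length (body e) ≡ 2 + e
length-body zero    = refl
length-body (suc e) = cong suc (length-body e)

length-startBlock : ∀ e → length (startBlock e) ≡ 2 + e
length-startBlock zero    = refl
length-startBlock (suc e) = cong suc (length-body e)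

Codes-body : ∀ {P} e q → (∀ v → q < v → v < 2 + (e + q) → ¬ P v) → P (2 + (e + q)) →
             Codes π P (body e) (suc q)
Codes-body zero q ¬P P-end = false⇔ (¬P (suc q) ≤-refl ≤-refl) , true⇔ P-end , tt
Codes-body {P} (suc e) q ¬P P-end =
  false⇔ (¬P (suc q) ≤-refl (s≤s (s≤s (m≤n⇒m≤1+n (m≤n+m q e))))) ,
  Codes-body e (suc q)
    (λ v lo hi → ¬P v (<⇒≤ lo) (subst (v <_) (cong (2 +_) (+-suc e q)) hi))
    (subst (P ∘ (2 +_)) (sym (+-suc e q)) P-end)

module HiccupWord (y₂ z₂ : ℕ) (a : ℕ → ℕ) (hic : IsHiccup 0 (2 + y₂) (2 + z₂) a) where

  t : ℕ → ℕ
  t n = a (suc n)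

  Earlier : ℕ → Set
  Earlier = EarlierValue a

  t-step-earlier : ∀ n → Earlier (2 + n) → t (suc n) ≡ t n + (2 + y₂)
  t-step-earlier n = proj₁ (proj₂ hic) (2 + n) (s≤s (s≤s z≤n))

  t-step-fresh : ∀ n → ¬ Earlier (2 + n) → t (suc n) ≡ t n + (2 + z₂)
  t-step-fresh n = proj₂ (proj₂ hic) (2 + n) (s≤s (s≤s z≤n))

  -- Earlier (2 + n) is not decided here; the goal is decidable, hence ¬¬-stable.
  t-jump : ∀ n → 2 + t n ≤ t (suc n)
  t-jump n = by-cases (2 + t n ≤? t (suc n))
    (λ ev → jump (t-step-earlier n ev)) (λ ¬ev → jump (t-step-fresh n ¬ev))
    where
    jump : ∀ {r} → t (suc n) ≡ t n + (2 + r) → 2 + t n ≤ t (suc n)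
    jump {r} eq = subst₂ _≤_ (+-comm (t n) 2) (sym eq) (+-monoʳ-≤ (t n) (m≤m+n 2 r))

  excess : ℕ → ℕ
  excess n = t (suc n) ∸ (2 + t n)

  t-suc : ∀ n → t (suc n) ≡ 2 + (excess n + t n)
  t-suc n = begin
    t (suc n)                  ≡⟨ sym (m∸n+n≡m (t-jump n)) ⟩
    excess n + (2 + t n)       ≡⟨ +-suc (excess n) (suc (t n)) ⟩
    suc (excess n + suc (t n)) ≡⟨ cong suc (+-suc (excess n) (t n)) ⟩
    2 + (excess n + t n)       ∎
    where open ≡-Reasoning

  excess-of : ∀ {n r} → t (suc n) ≡ t n + (2 + r) → excess n ≡ r
  excess-of {n} {r} eq = trans (cong (_∸ (2 + t n)) (trans eq (+-comm (t n) (2 + r))))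
                               (m+n∸n≡m r (t n))

  block : ℕ → List (Fin 4)
  block n = body (excess n)

  block-earlier : ∀ n → Earlier (2 + n) → block n ≡ body y₂
  block-earlier n = cong body ∘ excess-of ∘ t-step-earlier n

  block-fresh : ∀ n → ¬ Earlier (2 + n) → block n ≡ body z₂
  block-fresh n = cong body ∘ excess-of ∘ t-step-fresh n

  blocks : ℕ → ℕ → List (Fin 4)
  blocks n zero    = []
  blocks n (suc k) = block n ++ blocks (suc n) k

  blocks-++ : ∀ n k l → blocks n k ++ blocks (k + n) l ≡ blocks n (k + l)
  blocks-++ n zero    l = refl
  blocks-++ n (suc k) l = trans (++-assoc (block n) (blocks (suc n) k) _)
    (cong (block n ++_) (trans (cong (λ m → blocks (suc n) k ++ blocks m l) (sym (+-suc k n)))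
                               (blocks-++ (suc n) k l)))

  t-zero : t 0 ≡ 0
  t-zero = proj₁ hic

  ¬earlier-2 : ¬ Earlier 2
  ¬earlier-2 (suc zero , _ , _ , eq) with () ← trans (sym t-zero) eq
  ¬earlier-2 (suc (suc k) , _ , s≤s (s≤s ()) , _)

  t-one : t 1 ≡ 2 + z₂
  t-one = trans (t-step-fresh 0 ¬earlier-2) (cong (_+ (2 + z₂)) t-zero)

  t-mono : ∀ n → t n ≤ t (suc n)
  t-mono n = ≤-trans (m≤n+m (t n) 2) (t-jump n)

  n+n≤t : ∀ n → n + n ≤ t n
  n+n≤t zero    = z≤n
  n+n≤t (suc n) = subst (_≤ t (suc n)) (sym (cong suc (+-suc n n)))
                        (≤-trans (s≤s (s≤s (n+n≤t n))) (t-jump n))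

  ¬earlier-between : ∀ {n v} → t n < v → v < t (suc n) → ¬ Earlier v
  ¬earlier-between lo hi (suc k , _ , _ , eq) = ≢-between t-mono k lo hi eq

  ¬earlier-after : ∀ n → ¬ Earlier (suc (t n))
  ¬earlier-after n = ¬earlier-between ≤-refl (t-jump n)

  earlier-t : ∀ n → suc n < t n → Earlier (t n)
  earlier-t n lt = suc n , s≤s z≤n , lt , refl

  Term : ℕ → Set
  Term = InRange t

  ¬term-between : ∀ {n v} → t n < v → v < t (suc n) → ¬ Term v
  ¬term-between lo hi (k , _ , eq) = ≢-between t-mono k lo hi eq

  φ : Fin 4 → List (Fin 4)
  φ start = startBlock z₂
  φ gap   = body z₂
  φ pre   = body y₂
  φ hit   = body z₂

  φ-body : ∀ e q → (∀ v → q < v → v < 2 + (e + q) → ¬ Earlier v) →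
           Earlier (2 + (e + q)) → ¬ Earlier (3 + (e + q)) →
           concatMap φ (body e) ≡ blocks q (2 + e)
  φ-body zero q _ ev ¬ev =
    cong₂ _++_ (sym (block-earlier q ev)) (cong (_++ []) (sym (block-fresh (suc q) ¬ev)))
  φ-body (suc e) q ¬ev-inside ev ¬ev =
    cong₂ _++_ (sym (block-fresh q (¬ev-inside (2 + q) (n≤1+n _) (s≤s (s≤s (s≤s (m≤n+m q e)))))))
      (φ-body e (suc q)
        (λ v lo hi → ¬ev-inside v (<⇒≤ lo) (subst (v <_) (cong (2 +_) (+-suc e q)) hi))
        (subst (Earlier ∘ (2 +_)) (sym (+-suc e q)) ev)
        (subst (¬_ ∘ Earlier ∘ (3 +_)) (sym (+-suc e q)) ¬ev))

  φ-body-ending-at : ∀ m e q → t m ≡ 2 + (e + q) → suc m < t m →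
                     (∀ v → q < v → v < t m → ¬ Earlier v) →
                     concatMap φ (body e) ≡ blocks q (2 + e)
  φ-body-ending-at m e q end lt ¬ev-inside = φ-body e q
    (λ v lo hi → ¬ev-inside v lo (subst (v <_) (sym end) hi))
    (subst Earlier end (earlier-t m lt))
    (subst (¬_ ∘ Earlier ∘ suc) end (¬earlier-after m))

  φ-block : ∀ n → concatMap φ (block (suc n)) ≡ blocks (t (suc n)) (2 + excess (suc n))
  φ-block n = φ-body-ending-at (2 + n) (excess (suc n)) (t (suc n)) (t-suc (suc n)) late
    (λ _ → ¬earlier-between)
    where
    late : 3 + n < t (2 + n)
    late = ≤-trans (s≤s (s≤s (m≤n+m (2 + n) n))) (n+n≤t (2 + n))

  φ-blocks : ∀ n k → ∃ λ M → concatMap φ (blocks (suc n) k) ≡ blocks (t (suc n)) M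
  φ-blocks n zero    = 0 , refl
  φ-blocks n (suc k) with φ-blocks (suc n) k
  ... | M , eq = 2 + excess (suc n) + M , (begin
    concatMap φ (block (suc n) ++ blocks (2 + n) k)
      ≡⟨ concatMap-++ φ (block (suc n)) (blocks (2 + n) k) ⟩
    concatMap φ (block (suc n)) ++ concatMap φ (blocks (2 + n) k)
      ≡⟨ cong₂ _++_ (φ-block n) eq ⟩
    blocks (t (suc n)) (2 + excess (suc n)) ++ blocks (t (2 + n)) M
      ≡⟨ cong (λ m → blocks (t (suc n)) (2 + excess (suc n)) ++ blocks m M) (t-suc (suc n)) ⟩
    blocks (t (suc n)) (2 + excess (suc n)) ++ blocks (2 + excess (suc n) + t (suc n)) M
      ≡⟨ blocks-++ (t (suc n)) (2 + excess (suc n)) M ⟩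
    blocks (t (suc n)) (2 + excess (suc n) + M) ∎)
    where open ≡-Reasoning

  φ-afterStart : ∀ e → t 1 ≡ 2 + e → concatMap φ (afterStart e) ≡ blocks 1 (suc e)
  φ-afterStart zero    t₁ =
    cong (_++ []) (sym (block-fresh 1 (subst (¬_ ∘ Earlier ∘ suc) t₁ (¬earlier-after 1))))
  φ-afterStart (suc e) t₁ =
    φ-body-ending-at 1 e 1 (trans t₁ (cong (2 +_) (+-comm 1 e)))
      (subst (2 <_) (sym t₁) (s≤s (s≤s (s≤s z≤n))))
      (λ v lo hi → ¬earlier-between (subst (_< v) (sym t-zero) (<⇒≤ lo)) hi)

  word-shape : ∀ n → ∃ λ M → iter φ (suc n) (start ∷ []) ≡ startBlock z₂ ++ blocks 1 M
  word-shape zero = 0 , refl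
  word-shape (suc n) with word-shape n
  ... | M , eq with φ-blocks 0 M
  ...   | M′ , eq′ = suc z₂ + M′ , (begin
    concatMap φ (iter φ (suc n) (start ∷ []))
      ≡⟨ cong (concatMap φ) eq ⟩
    concatMap φ (startBlock z₂ ++ blocks 1 M)
      ≡⟨ concatMap-++ φ (startBlock z₂) (blocks 1 M) ⟩
    (startBlock z₂ ++ concatMap φ (afterStart z₂)) ++ concatMap φ (blocks 1 M)
      ≡⟨ cong₂ (λ u w → (startBlock z₂ ++ u) ++ w) (φ-afterStart z₂ t-one) eq′ ⟩
    (startBlock z₂ ++ blocks 1 (suc z₂)) ++ blocks (t 1) M′
      ≡⟨ ++-assoc (startBlock z₂) (blocks 1 (suc z₂)) (blocks (t 1) M′) ⟩
    startBlock z₂ ++ (blocks 1 (suc z₂) ++ blocks (t 1) M′)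
      ≡⟨ cong (λ m → startBlock z₂ ++ (blocks 1 (suc z₂) ++ blocks m M′))
              (trans t-one (cong suc (+-comm 1 z₂))) ⟩
    startBlock z₂ ++ (blocks 1 (suc z₂) ++ blocks (suc z₂ + 1) M′)
      ≡⟨ cong (startBlock z₂ ++_) (blocks-++ 1 (suc z₂) M′) ⟩
    startBlock z₂ ++ blocks 1 (suc z₂ + M′) ∎)
    where open ≡-Reasoning

  ¬term-1 : ¬ Term 1
  ¬term-1 = ¬term-between (subst (_< 1) (sym t-zero) ≤-refl)
                          (subst (1 <_) (sym t-one) (s≤s (s≤s z≤n)))

  Codes-afterStart : ∀ e → t 1 ≡ 2 + e → Codes π Term (afterStart e) 2
  Codes-afterStart zero    t₁ = true⇔ (1 , s≤s z≤n , t₁) , tt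
  Codes-afterStart (suc e) t₁ = Codes-body e 1
    (λ v lo hi → ¬term-between (subst (_< v) (sym t-zero) (<⇒≤ lo)) (subst (v <_) (sym t₁′) hi))
    (1 , s≤s z≤n , t₁′)
    where
    t₁′ : t 1 ≡ 2 + (e + 1)
    t₁′ = trans t₁ (cong (2 +_) (+-comm 1 e))

  Codes-block : ∀ n → Codes π Term (block n) (suc (t n))
  Codes-block n = Codes-body (excess n) (t n)
    (λ v lo hi → ¬term-between lo (subst (v <_) (sym (t-suc n)) hi))
    (suc n , s≤s z≤n , t-suc n)

  Codes-blocks : ∀ n k → Codes π Term (blocks n k) (suc (t n))
  Codes-blocks n zero    = tt
  Codes-blocks n (suc k) = Codes-++ π Term (block n) (suc (t n)) (Codes-block n)
    (subst (Codes π Term (blocks (suc n) k)) next (Codes-blocks (suc n) k))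
    where
    open ≡-Reasoning
    next : suc (t (suc n)) ≡ length (block n) + suc (t n)
    next = begin
      suc (t (suc n))              ≡⟨ cong suc (t-suc n) ⟩
      suc (2 + (excess n + t n))   ≡⟨ sym (+-suc (2 + excess n) (t n)) ⟩
      2 + excess n + suc (t n)     ≡⟨ cong (_+ suc (t n)) (sym (length-body (excess n))) ⟩
      length (block n) + suc (t n) ∎

  Codes-iter : ∀ n → Codes π Term (iter φ n (start ∷ [])) 1
  Codes-iter zero = false⇔ ¬term-1 , tt
  Codes-iter (suc n) with word-shape n
  ... | M , eq = subst (λ w → Codes π Term w 1) (sym eq)
    (Codes-++ π Term (startBlock z₂) 1 (false⇔ ¬term-1 , Codes-afterStart z₂ t-one)
      (subst (Codes π Term (blocks 1 M)) after-start (Codes-blocks 1 M)))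
    where
    after-start : suc (t 1) ≡ length (startBlock z₂) + 1
    after-start = trans (cong suc t-one) (trans (+-comm 1 (2 + z₂))
                                                (cong (_+ 1) (sym (length-startBlock z₂))))

  φ-expanding : ∀ x → 2 ≤ length (φ x)
  φ-expanding start = subst (2 ≤_) (sym (length-startBlock z₂)) (m≤m+n 2 z₂)
  φ-expanding gap   = subst (2 ≤_) (sym (length-body z₂)) (m≤m+n 2 z₂)
  φ-expanding pre   = subst (2 ≤_) (sym (length-body y₂)) (m≤m+n 2 y₂)
  φ-expanding hit   = subst (2 ≤_) (sym (length-body z₂)) (m≤m+n 2 z₂)

  morphic : MorphicSeq t
  morphic = morphic-by-codes φ φ-expanding start π (afterStart z₂ , refl) Codes-iter

lemma8 : (y z : ℕ) → 1 < y → 1 < z → y ≢ z →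
    (b : ℕ → ℕ) → IsHiccup (z ∸ 1) y z b →
    IsHiccup 0 y z (shiftSeq b) × MorphicSeq (λ n → shiftSeq b (suc n))
lemma8 (suc (suc y₂)) (suc (suc z₂)) (s≤s (s≤s z≤n)) (s≤s (s≤s z≤n)) _ b b-hiccup =
  a-hiccup , HiccupWord.morphic y₂ z₂ (shiftSeq b) a-hiccup
  where
  a-hiccup : IsHiccup 0 (2 + y₂) (2 + z₂) (shiftSeq b)
  a-hiccup = shiftSeq-isHiccup b b-hiccup
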